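{- Let $G$ be a connected graph, let $X\subseteq V(G)$ be a twin cover of $G$, and let $Y\subseteq X$ be such that every shortest path in $G$ of length at least $3$ contains a vertex of $Y$. Then $\operatorname{svcfc}(G)\le \chi(G)+|Y|$.
   Context: All graphs are finite, simple and undirected; the length of a path is its number of edges. For a vertex coloring $c\colon V(G)\to\mathbb{N}$, a path is conflict-free if some color appears on exactly one of its vertices. A coloring of a connected graph $G$ is a strong CFVC coloring if every two distinct vertices $u,v$ are joined by a conflict-free shortest $u$-$v$ path. $\operatorname{svcfc}(G)$ is the minimum number of colors of a strong CFVC coloring of $G$; $\chi(G)$ is the chromatic number. Vertices $u\neq v$ are true twins if $N_G[u]=N_G[v]$; a twin edge is an edge whose endpoints are true twins; $X\subseteq V(G)$ is a twin cover if every edge of $G-X$ is a twin edge. -}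

module Defs where

open import Data.Bool using (Bool; true; false)
open import Data.Nat using (ℕ; _≤_; _+_; _∸_)
open import Data.Fin using (Fin) renaming (_≟_ to _≟ᶠ_)
open import Data.Fin.Subset using (Subset; _∈_; _∉_)
open import Data.List using (List; []; _∷_; length; filter)
open import Data.List.Relation.Unary.Any using (Any)
open import Data.List.Relation.Unary.Unique.Propositional using (Unique)
open import Data.Product using (Σ; ∃; _×_)
open import Data.Sum using (_⊎_)
open import Relation.Binary.PropositionalEquality using (_≡_; _≢_)
open import Function.Bundles using (_⇔_)

record Graph : Set where
  field
    n      : ℕ
    E      : Fin n → Fin n → Bool
    sym    : ∀ u v → E u v ≡ E v u
    irrefl : ∀ u → E u u ≡ false

module _ (G : Graph) where
  open Graph G

  V : Set
  V = Fin n

  Adj : V → V → Set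
  Adj u v = E u v ≡ true

  data Walk : V → V → List V → Set where
    single : ∀ u → Walk u u (u ∷ [])
    step   : ∀ {u w v p} → Adj u w → Walk w v p → Walk u v (u ∷ p)

  IsPath : V → V → List V → Set
  IsPath u v p = Walk u v p × Unique p

  len : List V → ℕ
  len p = length p ∸ 1

  IsShortestPath : V → V → List V → Set
  IsShortestPath u v p = IsPath u v p × (∀ q → IsPath u v q → len p ≤ len q)

  Connected : Set
  Connected = ∀ u v → ∃ λ p → IsPath u v p

  InClosedNbhd : V → V → Set
  InClosedNbhd u w = w ≡ u ⊎ Adj u w

  TrueTwins : V → V → Set
  TrueTwins u v = u ≢ v × (∀ w → InClosedNbhd u w ⇔ InClosedNbhd v w)

  TwinEdge : V → V → Set
  TwinEdge u v = Adj u v × TrueTwins u v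

  TwinCover : Subset n → Set
  TwinCover X = ∀ u v → u ∉ X → v ∉ X → Adj u v → TwinEdge u v

  ProperColoring : (m : ℕ) → (V → Fin m) → Set
  ProperColoring m c = ∀ u v → Adj u v → c u ≢ c v

  ConflictFree : {m : ℕ} → (V → Fin m) → List V → Set
  ConflictFree c p = ∃ λ k → length (filter (λ w → c w ≟ᶠ k) p) ≡ 1

  StrongCFVC : (m : ℕ) → (V → Fin m) → Set
  StrongCFVC m c = ∀ u v → u ≢ v → ∃ λ p → IsShortestPath u v p × ConflictFree c p

  Colorable : ℕ → Set
  Colorable m = ∃ λ (c : V → Fin m) → ProperColoring m c

  SCFVCColorable : ℕ → Set
  SCFVCColorable m = ∃ λ (c : V → Fin m) → StrongCFVC m c

  IsChromaticNumber : ℕ → Set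
  IsChromaticNumber k = Colorable k × (∀ m → Colorable m → k ≤ m)

  IsSvcfc : ℕ → Set
  IsSvcfc s = SCFVCColorable s × (∀ m → SCFVCColorable m → s ≤ m)

{-# OPTIONS --safe #-}
module Submission where

-- Color the vertices of Y with |Y| fresh, pairwise distinct colors and the other
-- vertices by an optimal proper coloring. On a shortest path of length 1 or 2 the
-- first, respectively middle, vertex is adjacent to all others, so its color occurs
-- only once; a longer shortest path contains a vertex of Y, whose color occurs
-- nowhere else in the graph.

open import Defs
open import Data.Nat using (ℕ; _≤_; _+_)
open import Data.Fin.Subset using (Subset; _∈_; _⊆_; ∣_∣)
open import Data.List.Relation.Unary.Any using (Any)

open import Data.Bool using (true; false; _≟_)
open import Data.Fin using (Fin; zero; suc; join; splitAt) renaming (_≟_ to _≟ᶠ_)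
open import Data.Fin.Properties using (any?; splitAt-join)
import Data.Fin.Properties as Fin
open import Data.Fin.Subset using (_∉_)
open import Data.Fin.Subset.Properties using (_∈?_)
open import Data.List using (List; []; _∷_; length; filter)
open import Data.List.Membership.Propositional using (find) renaming (_∈_ to _∈ₗ_)
open import Data.List.Properties using (filter-accept; filter-reject; filter-none)
open import Data.List.Relation.Unary.All as All using (All; [])
open import Data.List.Relation.Unary.All.Properties using (¬Any⇒All¬)
open import Data.List.Relation.Unary.AllPairs using ([]; _∷_)
open import Data.List.Relation.Unary.Any using (here; there)
open import Data.List.Relation.Unary.Unique.Propositional using (Unique)
open import Data.Nat using (zero; suc; z≤n; s≤s)
open import Data.Nat.Properties using (suc-injective; ≤-refl; ≤-trans; m≤n⇒m≤1+n; ∸-monoˡ-≤)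
open import Data.Product using (∃; _×_; _,_)
open import Data.Sum using (_⊎_; inj₁; inj₂)
open import Data.Sum.Properties using (inj₁-injective; inj₂-injective)
open import Data.Vec using (_∷_; here; there)
open import Function.Bundles using (_⇔_; mk⇔)
open import Function.Base using (_∘_)
open import Function.Construct.Symmetry using (⇔-sym)
open import Relation.Binary.PropositionalEquality using (_≡_; _≢_; refl; sym; trans; cong; subst; module ≡-Reasoning)
open import Relation.Nullary using (Dec; yes; no; ¬_; contradiction; _×-dec_)
import Relation.Nullary.Decidable as Dec
open import Relation.Unary using (Decidable)

least-witness : {P : ℕ → Set} → Decidable P → ∀ {ℓ} → P ℓ
              → ∃ λ m → P m × (∀ {j} → P j → m ≤ j)
least-witness P? {ℓ} Pℓ with P? 0
... | yes P0 = 0 , P0 , λ _ → z≤n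
least-witness P? {zero}  Pℓ | no ¬P0 = contradiction Pℓ ¬P0
least-witness {P} P? {suc ℓ} Pℓ | no ¬P0 with least-witness (λ m → P? (suc m)) Pℓ
... | m , Pm , minimal = suc m , Pm , minimal′
  where
  minimal′ : ∀ {j} → P j → suc m ≤ j
  minimal′ {zero}  P0 = contradiction P0 ¬P0
  minimal′ {suc j} Pj = s≤s (minimal Pj)

length-filter-≡1 : ∀ {A : Set} {P : A → Set} (P? : Decidable P) {xs : List A} {y}
                 → Unique xs → y ∈ₗ xs → P y → (∀ {x} → x ∈ₗ xs → x ≢ y → ¬ P x)
                 → length (filter P? xs) ≡ 1
length-filter-≡1 {P = P} P? {x ∷ xs} (x∉xs ∷ _) (here refl) Px only
  = begin
    length (filter P? (x ∷ xs)) ≡⟨ cong length (filter-accept P? Px) ⟩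
    suc (length (filter P? xs)) ≡⟨ cong (suc ∘ length) (filter-none P? none) ⟩
    1                           ∎
  where
  open ≡-Reasoning
  none : All (λ z → ¬ P z) xs
  none = All.tabulate λ z∈xs → only (there z∈xs) λ z≡x → All.lookup x∉xs z∈xs (sym z≡x)
length-filter-≡1 P? {x ∷ xs} (x∉xs ∷ xs-unique) (there y∈xs) Py only
  rewrite filter-reject P? {xs = xs} (only (here refl) (All.lookup x∉xs y∈xs))
  = length-filter-≡1 P? xs-unique y∈xs Py (λ x∈xs → only (there x∈xs))

index : ∀ {n} {Y : Subset n} {i : Fin n} → i ∈ Y → Fin ∣ Y ∣
index {Y = true  ∷ _} here      = zero
index {Y = true  ∷ _} (there p) = suc (index p)
index {Y = false ∷ _} (there p) = index p

index-injective : ∀ {n} {Y : Subset n} {i j : Fin n} (p : i ∈ Y) (q : j ∈ Y)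
                → index p ≡ index q → i ≡ j
index-injective {Y = true  ∷ _} here      here      _ = refl
index-injective {Y = true  ∷ _} (there p) (there q) e = cong suc (index-injective p q (Fin.suc-injective e))
index-injective {Y = false ∷ _} (there p) (there q) e = cong suc (index-injective p q e)

module _ {n k} (c : Fin n → Fin k) (Y : Subset n) where

  private
    colorTag : (v : Fin n) → Dec (v ∈ Y) → Fin k ⊎ Fin ∣ Y ∣
    colorTag v (yes v∈Y) = inj₂ (index v∈Y)
    colorTag v (no _)    = inj₁ (c v)

    colorTag-≡ : ∀ {x y} (x∈?Y : Dec (x ∈ Y)) (y∈?Y : Dec (y ∈ Y))
                → colorTag x x∈?Y ≡ colorTag y y∈?Y → x ≡ y ⊎ (x ∉ Y × y ∉ Y × c x ≡ c y)
    colorTag-≡ (yes x∈Y) (yes y∈Y) e = inj₁ (index-injective x∈Y y∈Y (inj₂-injective e))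
    colorTag-≡ (no x∉Y)  (no y∉Y)  e = inj₂ (x∉Y , y∉Y , inj₁-injective e)
    colorTag-≡ (yes _)   (no _)    ()
    colorTag-≡ (no _)    (yes _)   ()

  extendColoring : Fin n → Fin (k + ∣ Y ∣)
  extendColoring v = join k ∣ Y ∣ (colorTag v (v ∈? Y))

  extendColoring-≡ : ∀ {x y} → extendColoring x ≡ extendColoring y
                    → x ≡ y ⊎ (x ∉ Y × y ∉ Y × c x ≡ c y)
  extendColoring-≡ {x} {y} e = colorTag-≡ (x ∈? Y) (y ∈? Y) (begin
    colorTag x (x ∈? Y)                      ≡⟨ splitAt-join k ∣ Y ∣ _ ⟨
    splitAt k (extendColoring x)             ≡⟨ cong (splitAt k) e ⟩
    splitAt k (extendColoring y)             ≡⟨ splitAt-join k ∣ Y ∣ _ ⟩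
    colorTag y (y ∈? Y)                      ∎)
    where open ≡-Reasoning

module _ (G : Graph) where
  open Graph G using (n)
  open import Data.List.Membership.DecPropositional (_≟ᶠ_ {n}) using () renaming (_∈?_ to _∈ₗ?_)

  Adj-sym : ∀ {u v} → Adj G u v → Adj G v u
  Adj-sym {u} {v} uv = trans (Graph.sym G v u) uv

  Adj-irrefl : ∀ {u v} → Adj G u v → u ≢ v
  Adj-irrefl {u} uv refl with trans (sym (Graph.irrefl G u)) uv
  ... | ()

  length-walk : ∀ {u v p} → Walk G u v p → length p ≡ suc (len G p)
  length-walk (single _) = refl
  length-walk (step _ _) = refl

  HasWalkOfLength : ℕ → V G → V G → Set
  HasWalkOfLength m u v = ∃ λ p → Walk G u v p × len G p ≡ m

  hasWalkOfLength-zero : ∀ {u v} → HasWalkOfLength 0 u v ⇔ u ≡ v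
  hasWalkOfLength-zero = mk⇔ to λ { refl → _ , single _ , refl }
    where
    to : ∀ {u v} → HasWalkOfLength 0 u v → u ≡ v
    to (_ , single _ , _)         = refl
    to (_ , step _ wp , len≡0) with trans (sym (length-walk wp)) len≡0
    ... | ()

  hasWalkOfLength-suc : ∀ {m u v}
    → HasWalkOfLength (suc m) u v ⇔ (∃ λ w → Adj G u w × HasWalkOfLength m w v)
  hasWalkOfLength-suc = mk⇔ to from
    where
    to : ∀ {m u v} → HasWalkOfLength (suc m) u v → ∃ λ w → Adj G u w × HasWalkOfLength m w v
    to (_ , step uw wp , len≡) = _ , uw , _ , wp , suc-injective (trans (sym (length-walk wp)) len≡)
    from : ∀ {m u v} → (∃ λ w → Adj G u w × HasWalkOfLength m w v) → HasWalkOfLength (suc m) u v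
    from (_ , uw , _ , wp , refl) = _ , step uw wp , length-walk wp

  hasWalkOfLength? : ∀ m u v → Dec (HasWalkOfLength m u v)
  hasWalkOfLength? zero    u v = Dec.map (⇔-sym hasWalkOfLength-zero) (u ≟ᶠ v)
  hasWalkOfLength? (suc m) u v = Dec.map (⇔-sym hasWalkOfLength-suc)
    (any? λ w → (Graph.E G u w ≟ true) ×-dec hasWalkOfLength? m w v)

  walk-suffix⇒path : ∀ {w v x p} → Walk G w v p → Unique p → x ∈ₗ p
                   → ∃ λ q → IsPath G x v q × length q ≤ length p
  walk-suffix⇒path wp@(single _)  p-unique       (here refl) = _ , (wp , p-unique) , ≤-refl
  walk-suffix⇒path wp@(step _ _)  p-unique       (here refl) = _ , (wp , p-unique) , ≤-refl
  walk-suffix⇒path (single _)     _              (there ())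
  walk-suffix⇒path (step _ wp)    (_ ∷ p-unique) (there x∈p) with walk-suffix⇒path wp p-unique x∈p
  ... | q , path , q≤p = q , path , m≤n⇒m≤1+n q≤p

  walk⇒path : ∀ {u v p} → Walk G u v p → ∃ λ q → IsPath G u v q × length q ≤ length p
  walk⇒path (single u) = _ , (single u , [] ∷ []) , ≤-refl
  walk⇒path (step {u = u} uw wp) with walk⇒path wp
  ... | q , (wq , q-unique) , q≤p with u ∈ₗ? q
  ...   | no u∉q = u ∷ q , (step uw wq , ¬Any⇒All¬ q u∉q ∷ q-unique) , s≤s q≤p
  ...   | yes u∈q with walk-suffix⇒path wq q-unique u∈q
  ...     | r , path , r≤q = r , path , m≤n⇒m≤1+n (≤-trans r≤q q≤p)

  shortestPath : ∀ {u v} → (∃ λ p → IsPath G u v p) → ∃ λ p → IsShortestPath G u v p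
  shortestPath {u} {v} (p , wp , _) with least-witness (λ m → hasWalkOfLength? m u v) (p , wp , refl)
  ... | _ , (p′ , wp′ , refl) , minimal with walk⇒path wp′
  ... | q , path , q≤p′ = q , path , λ _ (wq′ , _) → ≤-trans (∸-monoˡ-≤ 1 q≤p′) (minimal (_ , wq′ , refl))

  extendColoring-proper : ∀ {k} (c : V G → Fin k) (Y : Subset n) → ProperColoring G k c
                        → ProperColoring G (k + ∣ Y ∣) (extendColoring c Y)
  extendColoring-proper c Y c-proper x y xy e with extendColoring-≡ c Y e
  ... | inj₁ x≡y               = Adj-irrefl xy x≡y
  ... | inj₂ (_ , _ , cx≡cy)   = c-proper x y xy cx≡cy

  extendColoring-Y-unique : ∀ {k} (c : V G → Fin k) (Y : Subset n) {x y}
                          → y ∈ Y → x ≢ y → extendColoring c Y x ≢ extendColoring c Y y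
  extendColoring-Y-unique c Y y∈Y x≢y e with extendColoring-≡ c Y e
  ... | inj₁ x≡y             = x≢y x≡y
  ... | inj₂ (_ , y∉Y , _)   = y∉Y y∈Y

  UniquelyColoredIn : ∀ {m} → (V G → Fin m) → List (V G) → V G → Set
  UniquelyColoredIn f p y = y ∈ₗ p × (∀ {x} → x ∈ₗ p → x ≢ y → f x ≢ f y)

  uniquelyColored⇒conflictFree : ∀ {m} {f : V G → Fin m} {p} → Unique p
                              → ∃ (UniquelyColoredIn f p) → ConflictFree G f p
  uniquelyColored⇒conflictFree {f = f} p-unique (y , y∈p , only) =
    f y , length-filter-≡1 (λ w → f w ≟ᶠ f y) p-unique y∈p refl only

  module _ {m} {f : V G → Fin m} (f-proper : ProperColoring G m f) {Y : Subset n}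
           (Y-unique : ∀ {x y} → y ∈ Y → x ≢ y → f x ≢ f y) where

    walk-uniquelyColored : ∀ {u v p} → u ≢ v → Walk G u v p → (3 ≤ len G p → Any (_∈ Y) p)
                         → ∃ (UniquelyColoredIn f p)
    walk-uniquelyColored u≢v (single _) _ = contradiction refl u≢v
    walk-uniquelyColored {u} _ (step {w = v} uv (single _)) _ = u , here refl , only
      where
      only : ∀ {x} → x ∈ₗ u ∷ v ∷ [] → x ≢ u → f x ≢ f u
      only (here refl)         x≢u = contradiction refl x≢u
      only (there (here refl)) _   = f-proper v u (Adj-sym uv)
      only (there (there ()))
    walk-uniquelyColored {u} {v} _ (step {w = w} uw (step wv (single _))) _ = w , there (here refl) , only
      where
      only : ∀ {x} → x ∈ₗ u ∷ w ∷ v ∷ [] → x ≢ w → f x ≢ f w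
      only (here refl)                 _   = f-proper u w uw
      only (there (here refl))         x≢w = contradiction refl x≢w
      only (there (there (here refl))) _   = f-proper v w (Adj-sym wv)
      only (there (there (there ())))
    walk-uniquelyColored _ (step _ (step _ (step _ wp))) long-hits-Y
      with find (long-hits-Y (subst (λ ℓ → 3 ≤ 2 + ℓ) (sym (length-walk wp)) (s≤s (s≤s (s≤s z≤n)))))
    ... | y , y∈p , y∈Y = y , y∈p , λ _ → Y-unique y∈Y

theorem2 : (G : Graph) → Connected G
    → (X Y : Subset (Graph.n G)) → TwinCover G X → Y ⊆ X
    → (∀ u v p → IsShortestPath G u v p → 3 ≤ len G p → Any (λ y → y ∈ Y) p)
    → (k s : ℕ) → IsChromaticNumber G k → IsSvcfc G s
    → s ≤ k + ∣ Y ∣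
theorem2 G connected _ Y _ _ long-hits-Y k s ((c , c-proper) , _) (_ , svcfc-minimal) =
  svcfc-minimal (k + ∣ Y ∣) (color , strong)
  where
  color : V G → Fin (k + ∣ Y ∣)
  color = extendColoring c Y

  strong : StrongCFVC G (k + ∣ Y ∣) color
  strong u v u≢v with shortestPath G (connected u v)
  ... | p , shortest@((wp , p-unique) , _) = p , shortest , uniquelyColored⇒conflictFree G p-unique
    (walk-uniquelyColored G (extendColoring-proper G c Y c-proper) (extendColoring-Y-unique G c Y)
                          u≢v wp (long-hits-Y u v p shortest))
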